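{- Let $S$ be a numerical semigroup and let $I,I'$ be proper maximum sparse ideals of $S$. If $I'\supseteq I$, then $\#(S\setminus I)-\#(S\setminus I')\in S$.
   Context: A numerical semigroup $S$ is a subset of $\mathbb{N}_0$ containing $0$, closed under addition, with finite complement; its genus is $g=\#(\mathbb{N}_0\setminus S)$. An ideal of $S$ is a subset $I\subseteq S$ with $I+S\subseteq I$; it is proper if $I\neq S$. The Frobenius number of an ideal $I$ is the largest integer not in $I$. It is known that it is at most $2g-1+\#(S\setminus I)$; ideals attaining this bound are called maximum sparse. -}

module Defs where

open import Data.Bool using (Bool; true; false; not; _∧_)
open import Data.Nat using (ℕ; zero; suc; _+_; _*_; _≤_; _<_)
open import Data.Product using (Σ; _×_; ∃-syntax)
open import Relation.Binary.PropositionalEquality using (_≡_)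

Subset : Set
Subset = ℕ → Bool

_∈_ : ℕ → Subset → Set
n ∈ A = A n ≡ true

_∉_ : ℕ → Subset → Set
n ∉ A = A n ≡ false

_⊆_ : Subset → Subset → Set
A ⊆ B = ∀ n → n ∈ A → n ∈ B

_∖_ : Subset → Subset → Subset
(A ∖ B) n = A n ∧ not (B n)

countBelow : Subset → ℕ → ℕ
countBelow A zero = 0
countBelow A (suc c) with A c
... | true  = suc (countBelow A c)
... | false = countBelow A c

HasCard : Subset → ℕ → Set
HasCard A k = ∃[ c ] ((∀ n → c ≤ n → n ∉ A) × countBelow A c ≡ k)

compl : Subset → Subset
compl S n = not (S n)

record IsNumericalSemigroup (S : Subset) : Set where
  field
    zero-mem : 0 ∈ S
    add-closed : ∀ a b → a ∈ S → b ∈ S → (a + b) ∈ S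
    cofinite : ∃[ c ] (∀ n → c ≤ n → n ∈ S)

IsGenus : Subset → ℕ → Set
IsGenus S g = HasCard (compl S) g

record IsIdeal (S I : Subset) : Set where
  field
    sub : I ⊆ S
    closed : ∀ i s → i ∈ I → s ∈ S → (i + s) ∈ I

-- proper: I ≠ S (given I ⊆ S, some element of S lies outside I)
IsProper : Subset → Subset → Set
IsProper S I = ∃[ s ] (s ∈ S × s ∉ I)

-- f is the Frobenius number of I (the largest integer not in I); for a
-- proper ideal this is a natural number.
IsFrobenius : Subset → ℕ → Set
IsFrobenius I f = f ∉ I × (∀ n → f < n → n ∈ I)

-- maximum sparse: F(I) = 2g - 1 + #(S ∖ I), written as F(I) + 1 = 2g + #(S ∖ I)
IsMaximumSparse : Subset → Subset → Set
IsMaximumSparse S I =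
  ∃[ g ] ∃[ f ] ∃[ k ]
    (IsGenus S g × IsFrobenius I f × HasCard (S ∖ I) k × f + 1 ≡ 2 * g + k)

-- Let I be maximum sparse with Frobenius number F, and count in [0, F]: there are
-- a ≤ g gaps of S, k elements of S ∖ I and c elements of I, so a + c = 2g.  Since F ∉ I
-- and I is an ideal, n ↦ F − n maps I ∩ [0, F] injectively into the gaps, so c ≤ a;
-- hence a = c = g and the map is onto: F − h ∈ I for every gap h ≤ F.
-- For I ⊆ I′ maximum sparse we get F′ ≤ F and #(S ∖ I) − #(S ∖ I′) = F − F′ =: d.
-- If d were a gap, F − d = F′ would lie in I ⊆ I′, which is absurd.
module Submission where

open import Defs
open import Data.Nat using (ℕ; _+_)
open import Data.Product using (_×_; ∃-syntax)
open import Relation.Binary.PropositionalEquality using (_≡_)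

open import Data.Bool using (Bool; true; false; not; _∧_)
open import Data.Bool.Properties using (∧-zeroʳ)
open import Data.Empty using (⊥-elim)
open import Data.Nat using (zero; suc; _*_; _∸_; _≤_; _<_; z≤n; s≤s; s≤s⁻¹; _≤?_)
open import Data.Nat.Properties
open import Algebra.Properties.CommutativeSemigroup +-commutativeSemigroup using (x∙yz≈y∙xz)
open import Data.Nat.Solver using (module +-*-Solver)
open import Data.Product using (_,_)
open import Data.Sum using (inj₁; inj₂)
open import Relation.Nullary using (¬_; yes; no)
open import Relation.Binary.PropositionalEquality
  using (refl; sym; trans; cong; cong₂; subst; subst₂; module ≡-Reasoning)

toℕ : Bool → ℕ
toℕ false = 0
toℕ true  = 1

toℕ-mono : ∀ {a b} → (a ≡ true → b ≡ true) → toℕ a ≤ toℕ b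
toℕ-mono {false}         _ = z≤n
toℕ-mono {true}  {true}  _ = ≤-refl
toℕ-mono {true}  {false} f with f refl
... | ()

∈⇒∉⇒⊥ : ∀ n A → n ∈ A → ¬ (n ∉ A)
∈⇒∉⇒⊥ n A n∈A n∉A with trans (sym n∈A) n∉A
... | ()

_⊆⟨_⟩_ : Subset → ℕ → Subset → Set
A ⊆⟨ c ⟩ B = ∀ n → n < c → n ∈ A → n ∈ B

⊆⟨suc⟩⇒⊆ : ∀ {A B c} → A ⊆⟨ suc c ⟩ B → A ⊆⟨ c ⟩ B
⊆⟨suc⟩⇒⊆ A⊆B n n<c = A⊆B n (m≤n⇒m≤1+n n<c)

countBelow-suc : ∀ A c → countBelow A (suc c) ≡ toℕ (A c) + countBelow A c
countBelow-suc A c with A c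
... | true  = refl
... | false = refl

countBelow-cong : ∀ A B c → (∀ n → n < c → A n ≡ B n) → countBelow A c ≡ countBelow B c
countBelow-cong A B zero    A≗B = refl
countBelow-cong A B (suc c) A≗B
  rewrite countBelow-suc A c | countBelow-suc B c | A≗B c ≤-refl =
  cong (toℕ (B c) +_) (countBelow-cong A B c (λ n n<c → A≗B n (m≤n⇒m≤1+n n<c)))

countBelow-mono : ∀ A B c → A ⊆⟨ c ⟩ B → countBelow A c ≤ countBelow B c
countBelow-mono A B zero    A⊆B = z≤n
countBelow-mono A B (suc c) A⊆B rewrite countBelow-suc A c | countBelow-suc B c =
  +-mono-≤ (toℕ-mono (A⊆B c ≤-refl)) (countBelow-mono A B c (⊆⟨suc⟩⇒⊆ A⊆B))

countBelow-mono-< : ∀ A B c → A ⊆⟨ c ⟩ B → ∀ n → n < c → n ∈ B → n ∉ A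
                  → countBelow A c < countBelow B c
countBelow-mono-< A B (suc c) A⊆B n n<1+c n∈B n∉A
  rewrite countBelow-suc A c | countBelow-suc B c
  with m≤n⇒m<n∨m≡n (s≤s⁻¹ n<1+c)
... | inj₁ n<c = subst (_≤ toℕ (B c) + countBelow B c) (+-suc (toℕ (A c)) (countBelow A c))
  (+-mono-≤ (toℕ-mono (A⊆B c ≤-refl))
            (countBelow-mono-< A B c (⊆⟨suc⟩⇒⊆ A⊆B) n n<c n∈B n∉A))
... | inj₂ refl rewrite n∉A | n∈B = s≤s (countBelow-mono A B n (⊆⟨suc⟩⇒⊆ A⊆B))

countBelow-≤⇒⊇ : ∀ A B c → A ⊆⟨ c ⟩ B → countBelow B c ≤ countBelow A c → B ⊆⟨ c ⟩ A
countBelow-≤⇒⊇ A B c A⊆B B≤A n n<c n∈B with A n in eq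
... | true  = refl
... | false = ⊥-elim (<-irrefl refl (≤-trans (countBelow-mono-< A B c A⊆B n n<c n∈B eq) B≤A))

countBelow-monoʳ : ∀ A c m → countBelow A c ≤ countBelow A (m + c)
countBelow-monoʳ A c zero    = ≤-refl
countBelow-monoʳ A c (suc m) rewrite countBelow-suc A (m + c) =
  ≤-trans (countBelow-monoʳ A c m) (m≤n+m _ _)

countBelow-stable : ∀ A c → (∀ n → c ≤ n → n ∉ A) → ∀ m → countBelow A (m + c) ≡ countBelow A c
countBelow-stable A c beyond-c zero    = refl
countBelow-stable A c beyond-c (suc m)
  rewrite countBelow-suc A (m + c) | beyond-c (m + c) (m≤n+m c m) =
  countBelow-stable A c beyond-c m

HasCard⇒countBelow≤ : ∀ {A k} → HasCard A k → ∀ N → countBelow A N ≤ k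
HasCard⇒countBelow≤ {A} (c , beyond-c , count≡k) N = begin
  countBelow A N       ≤⟨ countBelow-monoʳ A N c ⟩
  countBelow A (c + N) ≡⟨ cong (countBelow A) (+-comm c N) ⟩
  countBelow A (N + c) ≡⟨ countBelow-stable A c beyond-c N ⟩
  countBelow A c       ≡⟨ count≡k ⟩
  _                    ∎
  where open ≤-Reasoning

HasCard⇒countBelow≡ : ∀ {A k} → HasCard A k → ∀ N → (∀ n → N ≤ n → n ∉ A) → countBelow A N ≡ k
HasCard⇒countBelow≡ {A} (c , beyond-c , count≡k) N beyond-N = begin
  countBelow A N       ≡⟨ countBelow-stable A N beyond-N c ⟨
  countBelow A (c + N) ≡⟨ cong (countBelow A) (+-comm c N) ⟩
  countBelow A (N + c) ≡⟨ countBelow-stable A c beyond-c N ⟩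
  countBelow A c       ≡⟨ count≡k ⟩
  _                    ∎
  where open ≡-Reasoning

HasCard-unique : ∀ {A k k′} → HasCard A k → HasCard A k′ → k ≡ k′
HasCard-unique hk (c′ , beyond-c′ , count≡k′) =
  trans (sym (HasCard⇒countBelow≡ hk c′ beyond-c′)) count≡k′

countBelow-shift : ∀ P c → countBelow P (suc c) ≡ toℕ (P 0) + countBelow (λ n → P (suc n)) c
countBelow-shift P zero = countBelow-suc P 0
countBelow-shift P (suc c)
  rewrite countBelow-suc P (suc c) | countBelow-shift P c | countBelow-suc (λ n → P (suc n)) c =
  x∙yz≈y∙xz (toℕ (P (suc c))) (toℕ (P 0)) (countBelow (λ n → P (suc n)) c)

countBelow-reflect : ∀ P F → countBelow (λ n → P (F ∸ n)) (suc F) ≡ countBelow P (suc F)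
countBelow-reflect P zero = trans (countBelow-suc (λ n → P (0 ∸ n)) 0) (sym (countBelow-suc P 0))
countBelow-reflect P (suc F)
  rewrite countBelow-suc (λ n → P (suc F ∸ n)) (suc F) | n∸n≡0 F | countBelow-shift P (suc F) =
  cong (toℕ (P 0) +_) (begin
    countBelow (λ n → P (suc F ∸ n)) (suc F)
      ≡⟨ countBelow-cong _ _ (suc F) (λ n n≤F → cong P (+-∸-assoc 1 (s≤s⁻¹ n≤F))) ⟩
    countBelow (λ n → P (suc (F ∸ n))) (suc F)
      ≡⟨ countBelow-reflect (λ n → P (suc n)) F ⟩
    countBelow (λ n → P (suc n)) (suc F) ∎)
  where open ≡-Reasoning

countBelow-partition : ∀ S I c → I ⊆ S →
  countBelow (compl S) c + countBelow I c + countBelow (S ∖ I) c ≡ c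
countBelow-partition S I zero    I⊆S = refl
countBelow-partition S I (suc c) I⊆S
  rewrite countBelow-suc (compl S) c | countBelow-suc I c | countBelow-suc (S ∖ I) c =
  trans (regroup (toℕ (compl S c)) (toℕ (I c)) (toℕ ((S ∖ I) c))
                 (countBelow (compl S) c) (countBelow I c) (countBelow (S ∖ I) c))
        (cong₂ _+_ (pointwise (I⊆S c)) (countBelow-partition S I c I⊆S))
  where
  open +-*-Solver
  regroup : ∀ x y z a b c → (x + a) + (y + b) + (z + c) ≡ (x + y + z) + (a + b + c)
  regroup = solve 6 (λ x y z a b c → (x :+ a) :+ (y :+ b) :+ (z :+ c)
                                   := (x :+ y :+ z) :+ (a :+ b :+ c)) refl
  pointwise : (c ∈ I → c ∈ S) → toℕ (compl S c) + toℕ (I c) + toℕ ((S ∖ I) c) ≡ 1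
  pointwise c∈I⇒c∈S with S c | I c
  ... | true  | true  = refl
  ... | true  | false = refl
  ... | false | false = refl
  ... | false | true  with c∈I⇒c∈S refl
  ... | ()

Frobenius-⊆⇒≥ : ∀ {I I′ F F′} → I ⊆ I′ → IsFrobenius I F → IsFrobenius I′ F′ → F′ ≤ F
Frobenius-⊆⇒≥ {I′ = I′} {F} {F′} I⊆I′ (_ , above-F) (F′∉I′ , _) with F′ ≤? F
... | yes F′≤F = F′≤F
... | no  F′≰F = ⊥-elim (∈⇒∉⇒⊥ F′ I′ (I⊆I′ F′ (above-F F′ (≰⇒> F′≰F))) F′∉I′)

Frobenius∸ideal∉ : ∀ {S I F n} → IsIdeal S I → F ∉ I → n ≤ F → n ∈ I → (F ∸ n) ∉ S
Frobenius∸ideal∉ {S} {I} {F} {n} ideal F∉I n≤F n∈I with S (F ∸ n) in eq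
... | false = refl
... | true  = ⊥-elim (∈⇒∉⇒⊥ F I (subst (_∈ I) (m+[n∸m]≡n n≤F) (IsIdeal.closed ideal n (F ∸ n) n∈I eq)) F∉I)

maximumSparse-reflects-gaps : ∀ {S I g F k} → IsIdeal S I → IsFrobenius I F → IsGenus S g
  → HasCard (S ∖ I) k → F + 1 ≡ 2 * g + k → ∀ h → h ≤ F → h ∉ S → (F ∸ h) ∈ I
maximumSparse-reflects-gaps {S} {I} {g} {F} {k} ideal (F∉I , above-F) genus card sparse h h≤F h∉S =
  reflected⊆I (F ∸ h) (s≤s (m∸n≤m F h)) (subst (_∈ compl S) (sym (m∸[m∸n]≡n h≤F)) (cong not h∉S))
  where
  gaps members : ℕ
  gaps = countBelow (compl S) (suc F)
  members = countBelow I (suc F)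
  reflected : Subset
  reflected n = compl S (F ∸ n)
  I⊆reflected : I ⊆⟨ suc F ⟩ reflected
  I⊆reflected n n<1+F n∈I = cong not (Frobenius∸ideal∉ ideal F∉I (s≤s⁻¹ n<1+F) n∈I)
  members≤gaps : members ≤ gaps
  members≤gaps = subst (members ≤_) (countBelow-reflect (compl S) F)
                       (countBelow-mono I reflected (suc F) I⊆reflected)
  gaps≤g : gaps ≤ g
  gaps≤g = HasCard⇒countBelow≤ genus (suc F)
  S∖I-below : countBelow (S ∖ I) (suc F) ≡ k
  S∖I-below = HasCard⇒countBelow≡ card (suc F)
    (λ n F<n → trans (cong (λ b → S n ∧ not b) (above-F n F<n)) (∧-zeroʳ (S n)))
  gaps+members≡2g : gaps + members ≡ g + g
  gaps+members≡2g = +-cancelʳ-≡ k _ _ (begin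
    gaps + members + k                                 ≡⟨ cong (gaps + members +_) S∖I-below ⟨
    gaps + members + countBelow (S ∖ I) (suc F)        ≡⟨ countBelow-partition S I (suc F) (IsIdeal.sub ideal) ⟩
    suc F                                              ≡⟨ +-comm 1 F ⟩
    F + 1                                              ≡⟨ sparse ⟩
    2 * g + k                                          ≡⟨ cong (λ m → g + m + k) (+-identityʳ g) ⟩
    g + g + k                                          ∎)
    where open ≡-Reasoning
  gaps≤members : gaps ≤ members
  gaps≤members = +-cancelˡ-≤ gaps _ _ (begin
    gaps + gaps    ≤⟨ +-mono-≤ gaps≤g gaps≤g ⟩
    g + g          ≡⟨ gaps+members≡2g ⟨
    gaps + members ∎)
    where open ≤-Reasoning
  reflected⊆I : reflected ⊆⟨ suc F ⟩ I
  reflected⊆I = countBelow-≤⇒⊇ I reflected (suc F) I⊆reflected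
    (subst (_≤ members) (sym (countBelow-reflect (compl S) F)) gaps≤members)

maximumSparse-Frobenius : ∀ {S I g k} → IsMaximumSparse S I → IsGenus S g → HasCard (S ∖ I) k
  → ∃[ F ] (IsFrobenius I F × F + 1 ≡ 2 * g + k)
maximumSparse-Frobenius (g₀ , F , k₀ , genus₀ , frob , card₀ , sparse) genus card =
  F , frob , subst₂ (λ g′ k′ → F + 1 ≡ 2 * g′ + k′)
                    (HasCard-unique genus₀ genus) (HasCard-unique card₀ card) sparse

k≡k′+[F∸F′] : ∀ {F F′ n k k′} → F′ ≤ F → F + 1 ≡ n + k → F′ + 1 ≡ n + k′ → k ≡ k′ + (F ∸ F′)
k≡k′+[F∸F′] {F} {F′} {n} {k} {k′} F′≤F eq eq′ = +-cancelˡ-≡ n _ _ (begin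
  n + k                  ≡⟨ eq ⟨
  F + 1                  ≡⟨ cong (_+ 1) (m+[n∸m]≡n F′≤F) ⟨
  F′ + (F ∸ F′) + 1      ≡⟨ +-assoc F′ (F ∸ F′) 1 ⟩
  F′ + ((F ∸ F′) + 1)    ≡⟨ cong (F′ +_) (+-comm (F ∸ F′) 1) ⟩
  F′ + (1 + (F ∸ F′))    ≡⟨ +-assoc F′ 1 (F ∸ F′) ⟨
  F′ + 1 + (F ∸ F′)      ≡⟨ cong (_+ (F ∸ F′)) eq′ ⟩
  n + k′ + (F ∸ F′)      ≡⟨ +-assoc n k′ (F ∸ F′) ⟩
  n + (k′ + (F ∸ F′))    ∎)
  where open ≡-Reasoning

lemma3 : (S I I′ : Subset) → IsNumericalSemigroup S
       → IsIdeal S I → IsProper S I → IsMaximumSparse S I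
       → IsIdeal S I′ → IsProper S I′ → IsMaximumSparse S I′
       → I ⊆ I′
       → (k k′ : ℕ) → HasCard (S ∖ I) k → HasCard (S ∖ I′) k′
       → ∃[ d ] (k ≡ k′ + d × d ∈ S)
lemma3 S I I′ _ ideal _ sparse@(_ , _ , _ , genus , _) _ _ sparse′ I⊆I′ k k′ card card′
  with maximumSparse-Frobenius sparse genus card | maximumSparse-Frobenius sparse′ genus card′
... | F , frob , sparse-F | F′ , frob′@(F′∉I′ , _) , sparse-F′ =
  F ∸ F′ , k≡k′+[F∸F′] F′≤F sparse-F sparse-F′ , F∸F′∈S
  where
  F′≤F : F′ ≤ F
  F′≤F = Frobenius-⊆⇒≥ I⊆I′ frob frob′
  F∸F′∈S : (F ∸ F′) ∈ S
  F∸F′∈S with S (F ∸ F′) in gap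
  ... | true  = refl
  ... | false = ⊥-elim (∈⇒∉⇒⊥ F′ I′
    (I⊆I′ F′ (subst (_∈ I) (m∸[m∸n]≡n F′≤F)
      (maximumSparse-reflects-gaps ideal frob genus card sparse-F (F ∸ F′) (m∸n≤m F F′) gap)))
    F′∉I′)
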